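{- If there exists an infinite word satisfying the PVHH property, then there exists an infinite binary word satisfying the BAS property.
   Context: An infinite word over a finite set of integers has the PVHH property if it has no factor $xy$ with $|x|=|y|\ge1$ and $\sum x=\sum y$, where $\sum x$ is the sum of the letters of $x$. Two binary words are Abelian equivalent if they have the same numbers of $0$s and $1$s; an Abelian square is $uv$ with $u,v$ nonempty and Abelian equivalent. A position $i$ of an infinite word avoids Abelian squares if the suffix starting at $i$ has no prefix that is an Abelian square. An infinite binary word has the BAS property if there is $N\ge1$ such that every interval of $N$ consecutive positions contains a position avoiding Abelian squares. -}

module Defs where

open import Data.Nat using (ℕ; zero; suc; _+_; _≤_; _<_)
open import Data.Integer using (ℤ)
import Data.Integer as ℤ
open import Data.Bool using (Bool; true; false)
open import Data.List using (List)
open import Data.List.Membership.Propositional using (_∈_)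
open import Data.Product using (Σ; _×_; ∃; ∃-syntax)
open import Relation.Binary.PropositionalEquality using (_≡_)
open import Relation.Nullary using (¬_)

Word : Set → Set
Word A = ℕ → A

FiniteAlphabet : Word ℤ → Set
FiniteAlphabet w = Σ (List ℤ) (λ L → ∀ i → w i ∈ L)

factorSum : Word ℤ → ℕ → ℕ → ℤ
factorSum w i zero    = ℤ.0ℤ
factorSum w i (suc n) = w i ℤ.+ factorSum w (suc i) n

-- PVHH: no factor xy with |x| = |y| = n ≥ 1 and Σx = Σy.
-- The factor xy starts at position i; x = w[i, i+n), y = w[i+n, i+2n).
PVHH : Word ℤ → Set
PVHH w = ∀ (i n : ℕ) → 1 ≤ n → ¬ (factorSum w i n ≡ factorSum w (i + n) n)

count1 : Word Bool → ℕ → ℕ → ℕ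
count1 w i zero = 0
count1 w i (suc n) with w i
... | true  = suc (count1 w (suc i) n)
... | false = count1 w (suc i) n

-- Binary words: Bool, with false = 0 and true = 1.
-- The prefix of length 2n of the suffix at i is an Abelian square uv with
-- |u| = |v| = n ≥ 1: u and v have the same length, so they are Abelian
-- equivalent iff they have the same number of 1s (hence also of 0s).
AbelianSquareAt : Word Bool → ℕ → ℕ → Set
AbelianSquareAt w i n = 1 ≤ n × count1 w i n ≡ count1 w (i + n) n

AvoidsAbelianSquares : Word Bool → ℕ → Set
AvoidsAbelianSquares w i = ∀ n → ¬ AbelianSquareAt w i n

BAS : Word Bool → Set
BAS w = ∃[ N ] (1 ≤ N × (∀ j → ∃[ i ] (j ≤ i × i < j + N × AvoidsAbelianSquares w i)))

module Submission where

-- 1. Adding a bound B on the absolute values of the letters turns the integer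
--    word into a bounded word a over ℕ in which no two adjacent factors of the
--    same length have the same sum (DistinctAdjacentSums).
-- 2. A binary word is read through a height function F that rises by 0 or 1 at
--    each step, the word marking the rises.  An Abelian square of length 2n at
--    position i then says F (i + n) is the midpoint of F i and F (i + 2n).
-- 3. From a bounded word a we build F block by block.  Block j has length
--    L = 2H and base height Y j = 4 (a 0 + ... + a (j - 1) + j); inside it F
--    stays flat for one step, rises by the odd amount c j = 4 a j + 3, then
--    stays flat.  So every base height is a multiple of 4 and every even
--    positive offset inside a block sits at an odd height above the base.
-- 4. At a block start j L, write the half-length as n = ρ + p H with ρ < H.
--    If ρ > 0 the far end lies at an odd height, contradicting parity; if
--    ρ = 0 and p is odd the midpoint lies at an odd height, contradicting the
--    residue mod 4; if ρ = 0 and p = 2k the square is aligned with the blocks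
--    and the midpoint equation forces the sums of a over the blocks j .. j+k-1
--    and j+k .. j+2k-1 to agree, contradicting DistinctAdjacentSums.
-- Hence all block starts avoid Abelian squares, and every window of L + 1
-- consecutive positions contains one.

open import Defs
open import Data.Integer using (ℤ)
open import Data.Bool using (Bool; true; false)
open import Data.Product using (Σ; _×_; ∃; ∃-syntax; _,_)

open import Data.Nat
open import Data.Nat.Properties
open import Data.Nat.DivMod
open import Data.Nat.Divisibility using (divides)
open import Data.Nat.Tactic.RingSolver using (solve-∀)
open import Data.Sum using (_⊎_; inj₁; inj₂)
import Data.Sum as Sum
open import Data.Empty using (⊥-elim)
open import Data.List using (List; []; _∷_)
open import Data.List.Membership.Propositional using (_∈_)
open import Data.List.Relation.Unary.Any using (here; there)
open import Relation.Binary.PropositionalEquality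
open import Relation.Nullary using (¬_; does; yes; no)
open import Relation.Nullary.Decidable using (dec-true; dec-false)
import Data.Integer as ℤ
import Data.Integer.Properties as ℤₚ
import Data.Integer.Tactic.RingSolver as ℤSolver

UnitSteps : (ℕ → ℕ) → Set
UnitSteps F = ∀ t → F (suc t) ≡ F t ⊎ F (suc t) ≡ suc (F t)

risesOf : (ℕ → ℕ) → Word Bool
risesOf F t = does (F (suc t) ≟ suc (F t))

count1-true : ∀ w i n → w i ≡ true → count1 w i (suc n) ≡ suc (count1 w (suc i) n)
count1-true w i n wi≡true with w i
... | true = refl

count1-false : ∀ w i n → w i ≡ false → count1 w i (suc n) ≡ count1 w (suc i) n
count1-false w i n wi≡false with w i
... | false = refl

count1-risesOf : ∀ F → UnitSteps F → ∀ i n → count1 (risesOf F) i n + F i ≡ F (i + n)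
count1-risesOf F steps i zero = cong F (sym (+-identityʳ i))
count1-risesOf F steps i (suc n) with steps i
... | inj₂ rises = begin
  count1 w i (suc n) + F i       ≡⟨ cong (_+ F i) (count1-true w i n (dec-true (F (suc i) ≟ suc (F i)) rises)) ⟩
  suc (count1 w (suc i) n + F i) ≡⟨ sym (+-suc _ (F i)) ⟩
  count1 w (suc i) n + suc (F i) ≡⟨ cong (count1 w (suc i) n +_) (sym rises) ⟩
  count1 w (suc i) n + F (suc i) ≡⟨ count1-risesOf F steps (suc i) n ⟩
  F (suc i + n)                  ≡⟨ cong F (sym (+-suc i n)) ⟩
  F (i + suc n)                  ∎
  where
  open ≡-Reasoning
  w = risesOf F
... | inj₁ flat = begin
  count1 w i (suc n) + F i       ≡⟨ cong (_+ F i) (count1-false w i n (dec-false (F (suc i) ≟ suc (F i)) noRise)) ⟩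
  count1 w (suc i) n + F i       ≡⟨ cong (count1 w (suc i) n +_) (sym flat) ⟩
  count1 w (suc i) n + F (suc i) ≡⟨ count1-risesOf F steps (suc i) n ⟩
  F (suc i + n)                  ≡⟨ cong F (sym (+-suc i n)) ⟩
  F (i + suc n)                  ∎
  where
  open ≡-Reasoning
  w = risesOf F
  noRise : F (suc i) ≢ suc (F i)
  noRise rises = m≢1+n+m (F i) {0} (trans (sym flat) rises)

midpoint : ∀ F → UnitSteps F → ∀ i n → AbelianSquareAt (risesOf F) i n →
           F (i + n) + F (i + n) ≡ F i + F (i + n + n)
midpoint F steps i n (_ , sameCount) = begin
  F (i + n) + F (i + n)              ≡⟨ cong (_+ F (i + n)) (sym (count1-risesOf F steps i n)) ⟩
  (count1 w i n + F i) + F (i + n)   ≡⟨ cong (λ k → (k + F i) + F (i + n)) sameCount ⟩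
  (count1 w (i + n) n + F i) + F (i + n) ≡⟨ cong (_+ F (i + n)) (+-comm _ (F i)) ⟩
  (F i + count1 w (i + n) n) + F (i + n) ≡⟨ +-assoc (F i) _ _ ⟩
  F i + (count1 w (i + n) n + F (i + n)) ≡⟨ cong (F i +_) (count1-risesOf F steps (i + n) n) ⟩
  F i + F (i + n + n)                ∎
  where
  open ≡-Reasoning
  w = risesOf F

factorSumℕ : (ℕ → ℕ) → ℕ → ℕ → ℕ
factorSumℕ a i zero    = 0
factorSumℕ a i (suc n) = a i + factorSumℕ a (suc i) n

factorSumℕ-+ : ∀ a i m n → factorSumℕ a i (m + n) ≡ factorSumℕ a i m + factorSumℕ a (i + m) n
factorSumℕ-+ a i zero    n = cong (λ k → factorSumℕ a k n) (sym (+-identityʳ i))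
factorSumℕ-+ a i (suc m) n = begin
  a i + factorSumℕ a (suc i) (m + n)                             ≡⟨ cong (a i +_) (factorSumℕ-+ a (suc i) m n) ⟩
  a i + (factorSumℕ a (suc i) m + factorSumℕ a (suc i + m) n)    ≡⟨ sym (+-assoc (a i) _ _) ⟩
  a i + factorSumℕ a (suc i) m + factorSumℕ a (suc i + m) n      ≡⟨ cong (λ k → a i + factorSumℕ a (suc i) m + factorSumℕ a k n) (sym (+-suc i m)) ⟩
  a i + factorSumℕ a (suc i) m + factorSumℕ a (i + suc m) n      ∎
  where open ≡-Reasoning

factorSumℕ-snoc : ∀ a n → factorSumℕ a 0 (suc n) ≡ factorSumℕ a 0 n + a n
factorSumℕ-snoc a n = begin
  factorSumℕ a 0 (suc n)              ≡⟨ cong (factorSumℕ a 0) (+-comm 1 n) ⟩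
  factorSumℕ a 0 (n + 1)              ≡⟨ factorSumℕ-+ a 0 n 1 ⟩
  factorSumℕ a 0 n + (a n + 0)        ≡⟨ cong (factorSumℕ a 0 n +_) (+-identityʳ (a n)) ⟩
  factorSumℕ a 0 n + a n              ∎
  where open ≡-Reasoning

-- The ℕ-valued form of PVHH: adjacent factors of equal length have distinct sums.
DistinctAdjacentSums : (ℕ → ℕ) → Set
DistinctAdjacentSums a = ∀ i n → 1 ≤ n → factorSumℕ a i n ≢ factorSumℕ a (i + n) n

⊓-step : ∀ m c → suc m ⊓ c ≡ m ⊓ c ⊎ suc m ⊓ c ≡ suc (m ⊓ c)
⊓-step m       zero    = inj₁ (sym (⊓-zeroʳ m))
⊓-step zero    (suc c) = inj₂ refl
⊓-step (suc m) (suc c) = Sum.map (cong suc) (cong suc) (⊓-step m c)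

evenOrOdd : ∀ p → (∃[ k ] p ≡ 2 * k) ⊎ (∃[ k ] p ≡ suc (2 * k))
evenOrOdd zero    = inj₁ (0 , refl)
evenOrOdd (suc p) with evenOrOdd p
... | inj₁ (k , p≡2k)   = inj₂ (k , cong suc p≡2k)
... | inj₂ (k , p≡2k+1) = inj₁ (suc k , trans (cong suc p≡2k+1) (sym (*-suc 2 k)))

double-< : ∀ {s h} → suc s < h → suc (suc (2 * s)) < 2 * h
double-< {s} s<h = ≤-trans (n≤1+n _) (≤-trans (≤-reflexive (lemma s)) (*-monoʳ-≤ 2 s<h))
  where
  lemma : ∀ s → suc (suc (suc (suc (2 * s)))) ≡ 2 * suc (suc s)
  lemma = solve-∀

double≢4+odd : ∀ x y z u → x + x ≢ 4 * y + (4 * z + suc (2 * u))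
double≢4+odd x y z u eq = even≢odd x (2 * y + 2 * z + u) (trans (double x) (trans eq (regroup y z u)))
  where
  double : ∀ x → 2 * x ≡ x + x
  double = solve-∀
  regroup : ∀ y z u → 4 * y + (4 * z + suc (2 * u)) ≡ suc (2 * (2 * y + 2 * z + u))
  regroup = solve-∀

doubleOdd≢4 : ∀ x y z u → (4 * x + suc (2 * u)) + (4 * x + suc (2 * u)) ≢ 4 * y + 4 * z
doubleOdd≢4 x y z u eq = even≢odd (y + z) (2 * x + u) (sym (*-cancelˡ-≡ _ _ 2 (trans (lhs x u) (trans eq (rhs y z)))))
  where
  lhs : ∀ x u → 2 * suc (2 * (2 * x + u)) ≡ (4 * x + suc (2 * u)) + (4 * x + suc (2 * u))
  lhs = solve-∀
  rhs : ∀ y z → 4 * y + 4 * z ≡ 2 * (2 * (y + z))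
  rhs = solve-∀

-- Arithmetic core of the aligned case: with prefix sums A, A + B, A + B + C at
-- block indices j, j + k, j + 2k, the midpoint equation of the base heights
-- forces B = C.
midpoint-cancel : ∀ A B C j k →
  4 * (A + B + (j + k)) + 4 * (A + B + (j + k)) ≡ 4 * (A + j) + 4 * (A + B + C + (j + k + k)) → B ≡ C
midpoint-cancel A B C j k eq =
  *-cancelˡ-≡ B C 4 (+-cancelʳ-≡ rest (4 * B) (4 * C) (trans (lhs A B j k) (trans eq (rhs A B C j k))))
  where
  rest : ℕ
  rest = 8 * A + 4 * B + 8 * j + 8 * k
  lhs : ∀ A B j k → 4 * B + (8 * A + 4 * B + 8 * j + 8 * k) ≡ 4 * (A + B + (j + k)) + 4 * (A + B + (j + k))
  lhs = solve-∀
  rhs : ∀ A B C j k → 4 * (A + j) + 4 * (A + B + C + (j + k + k)) ≡ 4 * C + (8 * A + 4 * B + 8 * j + 8 * k)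
  rhs = solve-∀

module Blocks (a : ℕ → ℕ) (M : ℕ) (a≤M : ∀ i → a i ≤ M) where

  H : ℕ
  H = suc (suc (2 * suc M))

  L : ℕ
  L = 2 * H

  -- Rise of F inside block j: odd, and small enough to fit in the block.
  c : ℕ → ℕ
  c j = suc (2 * (2 * a j + 1))

  Y : ℕ → ℕ
  Y j = 4 * (factorSumℕ a 0 j + j)

  rise : ℕ → ℕ → ℕ
  rise j zero    = 0
  rise j (suc r) = r ⊓ c j

  F : ℕ → ℕ
  F t = Y (t / L) + rise (t / L) (t % L)

  b : Word Bool
  b = risesOf F

  F-block : ∀ j r → r < L → F (r + j * L) ≡ Y j + rise j r
  F-block j r r<L = cong₂ (λ j′ r′ → Y j′ + rise j′ r′) quotient remainder
    where
    open ≡-Reasoning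
    remainder : (r + j * L) % L ≡ r
    remainder = trans ([m+kn]%n≡m%n r j L) (m<n⇒m%n≡m r<L)
    quotient : (r + j * L) / L ≡ j
    quotient = begin
      (r + j * L) / L       ≡⟨ +-distrib-/-∣ʳ r (divides j refl) ⟩
      r / L + j * L / L     ≡⟨ cong₂ _+_ (m<n⇒m/n≡0 r<L) (m*n/n≡m j L) ⟩
      j                     ∎

  F-start : ∀ j → F (j * L) ≡ Y j
  F-start j = trans (F-block j 0 (s≤s z≤n)) (+-identityʳ (Y j))

  Y-suc : ∀ j → Y (suc j) ≡ suc (Y j + c j)
  Y-suc j = begin
    4 * (factorSumℕ a 0 (suc j) + suc j)     ≡⟨ cong (λ s → 4 * (s + suc j)) (factorSumℕ-snoc a j) ⟩
    4 * (factorSumℕ a 0 j + a j + suc j)     ≡⟨ regroup (factorSumℕ a 0 j) (a j) j ⟩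
    suc (Y j + c j)                          ∎
    where
    open ≡-Reasoning
    regroup : ∀ s x j → 4 * (s + x + suc j) ≡ suc (4 * (s + j) + suc (2 * (2 * x + 1)))
    regroup = solve-∀

  c+2≤L : ∀ j → suc (suc (c j)) ≤ L
  c+2≤L j = ≤-trans (s≤s (s≤s (s≤s (*-monoʳ-≤ 2 (+-monoˡ-≤ 1 (*-monoʳ-≤ 2 (a≤M j)))))))
                    (subst (suc (suc (suc (2 * (2 * M + 1)))) ≤_) (slack M) (m≤m+n _ 3))
    where
    slack : ∀ M → suc (suc (suc (2 * (2 * M + 1)))) + 3 ≡ 2 * suc (suc (2 * suc M))
    slack = solve-∀

  rise-step : ∀ j r → rise j (suc r) ≡ rise j r ⊎ rise j (suc r) ≡ suc (rise j r)
  rise-step j zero    = inj₁ refl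
  rise-step j (suc r) = ⊓-step r (c j)

  rise-even : ∀ j s → rise j (suc (suc (2 * s))) ≡ suc (2 * (s ⊓ (2 * a j + 1)))
  rise-even j s = cong suc (sym (*-distribˡ-⊓ 2 s (2 * a j + 1)))

  -- Leaving the last position of a block is a rise: F reaches the next base.
  carry : ∀ j r → suc (suc r) ≡ L → F (suc (suc r) + j * L) ≡ suc (F (suc r + j * L))
  carry j r r+2≡L = begin
    F (suc (suc r) + j * L)      ≡⟨ cong (λ s → F (s + j * L)) r+2≡L ⟩
    F (suc j * L)                ≡⟨ F-start (suc j) ⟩
    Y (suc j)                    ≡⟨ Y-suc j ⟩
    suc (Y j + c j)              ≡⟨ cong (λ x → suc (Y j + x)) (sym (m≥n⇒m⊓n≡n c≤r)) ⟩
    suc (Y j + rise j (suc r))   ≡⟨ cong suc (sym (F-block j (suc r) (≤-reflexive r+2≡L))) ⟩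
    suc (F (suc r + j * L))      ∎
    where
    open ≡-Reasoning
    c≤r : c j ≤ r
    c≤r = s≤s⁻¹ (s≤s⁻¹ (subst (suc (suc (c j)) ≤_) (sym r+2≡L) (c+2≤L j)))

  stepAt : ∀ j r → r < L → F (suc r + j * L) ≡ F (r + j * L) ⊎ F (suc r + j * L) ≡ suc (F (r + j * L))
  stepAt j r r<L with suc r <? L
  ... | yes r+1<L rewrite F-block j (suc r) r+1<L | F-block j r r<L =
    Sum.map (cong (Y j +_)) (λ up → trans (cong (Y j +_) up) (+-suc (Y j) _)) (rise-step j r)
  stepAt j zero    r<L | no r+1≮L = ⊥-elim (r+1≮L (s≤s (s≤s z≤n)))
  stepAt j (suc r) r<L | no r+1≮L = inj₂ (carry j r (≤-antisym r<L (≮⇒≥ r+1≮L)))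

  unitSteps : UnitSteps F
  unitSteps t = subst (λ s → F (suc s) ≡ F s ⊎ F (suc s) ≡ suc (F s))
                      (sym (m≡m%n+[m/n]*n t L)) (stepAt (t / L) (t % L) (m%n<n t L))

  MidpointAtStart : ℕ → ℕ → Set
  MidpointAtStart j n = F (j * L + n) + F (j * L + n) ≡ Y j + F (j * L + n + n)

  -- n = ρ + p H with 0 < ρ < H: the far end is at an odd height above a base.
  unaligned : ∀ j s p → suc s < H → ¬ MidpointAtStart j (suc s + p * H)
  unaligned j s p s+1<H eq =
    double≢4+odd (F (j * L + n)) (factorSumℕ a 0 j + j) (factorSumℕ a 0 (j + p) + (j + p))
                 (s ⊓ (2 * a (j + p) + 1)) (trans eq (cong (Y j +_) farEnd))
    where
    open ≡-Reasoning
    n : ℕ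
    n = suc s + p * H
    position : ∀ j s p H → j * (2 * H) + (suc s + p * H) + (suc s + p * H) ≡ suc (suc (2 * s)) + (j + p) * (2 * H)
    position = solve-∀
    farEnd : F (j * L + n + n) ≡ Y (j + p) + suc (2 * (s ⊓ (2 * a (j + p) + 1)))
    farEnd = begin
      F (j * L + n + n)                            ≡⟨ cong F (position j s p H) ⟩
      F (suc (suc (2 * s)) + (j + p) * L)          ≡⟨ F-block (j + p) _ (double-< s+1<H) ⟩
      Y (j + p) + rise (j + p) (suc (suc (2 * s))) ≡⟨ cong (Y (j + p) +_) (rise-even (j + p) s) ⟩
      Y (j + p) + suc (2 * (s ⊓ (2 * a (j + p) + 1))) ∎

  -- n = 2k H = k L with k ≥ 1: the square covers the blocks j .. j + 2k - 1 and
  -- compares the sums of a over their two halves.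
  aligned : DistinctAdjacentSums a → ∀ j k → ¬ MidpointAtStart j (2 * suc k * H)
  aligned distinct j k eq = distinct j (suc k) (s≤s z≤n) (midpoint-cancel A B C j m baseHeights)
    where
    open ≡-Reasoning
    n : ℕ
    n = 2 * suc k * H
    m : ℕ
    m = suc k
    position₁ : ∀ j m H → j * (2 * H) + 2 * m * H ≡ (j + m) * (2 * H)
    position₁ = solve-∀
    position₂ : ∀ j m H → j * (2 * H) + 2 * m * H + 2 * m * H ≡ (j + m + m) * (2 * H)
    position₂ = solve-∀
    A : ℕ
    A = factorSumℕ a 0 j
    B : ℕ
    B = factorSumℕ a j m
    C : ℕ
    C = factorSumℕ a (j + m) m
    sums₁ : factorSumℕ a 0 (j + m) ≡ A + B
    sums₁ = factorSumℕ-+ a 0 j m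
    sums₂ : factorSumℕ a 0 (j + m + m) ≡ A + B + C
    sums₂ = trans (factorSumℕ-+ a 0 (j + m) m) (cong (_+ C) sums₁)
    baseHeights : 4 * (A + B + (j + m)) + 4 * (A + B + (j + m)) ≡ 4 * (A + j) + 4 * (A + B + C + (j + m + m))
    baseHeights = begin
      4 * (A + B + (j + m)) + 4 * (A + B + (j + m))
        ≡⟨ cong (λ s → 4 * (s + (j + m)) + 4 * (s + (j + m))) (sym sums₁) ⟩
      Y (j + m) + Y (j + m)
        ≡⟨ cong₂ _+_ (F-start (j + m)) (F-start (j + m)) ⟨
      F ((j + m) * L) + F ((j + m) * L)
        ≡⟨ cong (λ t → F t + F t) (position₁ j m H) ⟨
      F (j * L + n) + F (j * L + n)   ≡⟨ eq ⟩
      Y j + F (j * L + n + n)         ≡⟨ cong (λ t → Y j + F t) (position₂ j m H) ⟩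
      Y j + F ((j + m + m) * L)       ≡⟨ cong (Y j +_) (F-start (j + m + m)) ⟩
      Y j + Y (j + m + m)             ≡⟨ cong (λ s → Y j + 4 * (s + (j + m + m))) sums₂ ⟩
      4 * (A + j) + 4 * (A + B + C + (j + m + m)) ∎

  -- n = (2k + 1) H: the midpoint is half a block past a block start, at an odd
  -- height above a base, while both ends are at multiples of 4.
  halfShifted : ∀ j k → ¬ MidpointAtStart j (suc (2 * k) * H)
  halfShifted j k eq =
    doubleOdd≢4 (factorSumℕ a 0 (j + k) + (j + k)) (factorSumℕ a 0 j + j) (factorSumℕ a 0 (j + p) + (j + p))
                (suc M ⊓ (2 * a (j + k) + 1)) (begin
      middle + middle                          ≡⟨ cong₂ _+_ atMiddle atMiddle ⟨
      F (j * L + n) + F (j * L + n)            ≡⟨ eq ⟩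
      Y j + F (j * L + n + n)                  ≡⟨ cong (λ t → Y j + F t) (position₂ j k H) ⟩
      Y j + F ((j + p) * L)                    ≡⟨ cong (Y j +_) (F-start (j + p)) ⟩
      Y j + Y (j + p)                          ∎)
    where
    open ≡-Reasoning
    p : ℕ
    p = suc (2 * k)
    n : ℕ
    n = p * H
    middle : ℕ
    middle = Y (j + k) + suc (2 * (suc M ⊓ (2 * a (j + k) + 1)))
    position₁ : ∀ j k H → j * (2 * H) + suc (2 * k) * H ≡ H + (j + k) * (2 * H)
    position₁ = solve-∀
    position₂ : ∀ j k H → j * (2 * H) + suc (2 * k) * H + suc (2 * k) * H ≡ (j + suc (2 * k)) * (2 * H)
    position₂ = solve-∀
    atMiddle : F (j * L + n) ≡ middle
    atMiddle = begin
      F (j * L + n)                  ≡⟨ cong F (position₁ j k H) ⟩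
      F (H + (j + k) * L)            ≡⟨ F-block (j + k) H (m<m+n H (s≤s z≤n)) ⟩
      Y (j + k) + rise (j + k) H     ≡⟨ cong (Y (j + k) +_) (rise-even (j + k) (suc M)) ⟩
      middle                         ∎

  noMidpointAtStart : DistinctAdjacentSums a → ∀ j ρ p → ρ < H → 1 ≤ ρ + p * H → ¬ MidpointAtStart j (ρ + p * H)
  noMidpointAtStart distinct j (suc s) p s+1<H _ = unaligned j s p s+1<H
  noMidpointAtStart distinct j zero p _ 1≤n with evenOrOdd p
  ... | inj₁ (zero , refl)  = ⊥-elim (<-irrefl refl 1≤n)
  ... | inj₁ (suc k , refl) = aligned distinct j k
  ... | inj₂ (k , refl)     = halfShifted j k

  avoidsAtBlockStart : DistinctAdjacentSums a → ∀ j → AvoidsAbelianSquares b (j * L)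
  avoidsAtBlockStart distinct j n square@(1≤n , _) =
    noMidpointAtStart distinct j (n % H) (n / H) (m%n<n n H) (subst (1 ≤_) split 1≤n)
                      (subst (MidpointAtStart j) split atStart)
    where
    split : n ≡ n % H + n / H * H
    split = m≡m%n+[m/n]*n n H
    atStart : MidpointAtStart j n
    atStart = subst (λ h → F (j * L + n) + F (j * L + n) ≡ h + F (j * L + n + n))
                    (F-start j) (midpoint F unitSteps (j * L) n square)

  -- The next block start after position i lies in the window [i, i + L].
  bas : DistinctAdjacentSums a → BAS b
  bas distinct = suc L , s≤s z≤n , λ i → suc (i / L) * L , lower i , upper i , avoidsAtBlockStart distinct (suc (i / L))
    where
    lower : ∀ i → i ≤ suc (i / L) * L
    lower i = begin
      i                       ≡⟨ m≡m%n+[m/n]*n i L ⟩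
      i % L + i / L * L       ≤⟨ +-monoˡ-≤ (i / L * L) (<⇒≤ (m%n<n i L)) ⟩
      L + i / L * L           ∎
      where open ≤-Reasoning
    upper : ∀ i → suc (i / L) * L < i + suc L
    upper i = begin-strict
      L + i / L * L           ≤⟨ +-monoʳ-≤ L (m/n*n≤m i L) ⟩
      L + i                   <⟨ n<1+n (L + i) ⟩
      suc (L + i)             ≡⟨ cong suc (+-comm L i) ⟩
      suc (i + L)             ≡⟨ +-suc i L ⟨
      i + suc L               ∎
      where open ≤-Reasoning

basFromBoundedWord : ∀ a M → (∀ i → a i ≤ M) → DistinctAdjacentSums a → Σ (Word Bool) BAS
basFromBoundedWord a M a≤M distinct = Blocks.b a M a≤M , Blocks.bas a M a≤M distinct

absSum : List ℤ → ℕ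
absSum []       = 0
absSum (x ∷ xs) = ℤ.∣ x ∣ + absSum xs

∣member∣≤absSum : ∀ {x xs} → x ∈ xs → ℤ.∣ x ∣ ≤ absSum xs
∣member∣≤absSum (here refl) = m≤m+n _ _
∣member∣≤absSum {xs = y ∷ _} (there x∈xs) = ≤-trans (∣member∣≤absSum x∈xs) (m≤n+m _ ℤ.∣ y ∣)

-- x + B as a natural number, for |x| ≤ B.
shift : ℕ → ℤ → ℕ
shift B (ℤ.+ m)    = m + B
shift B ℤ.-[1+ m ] = B ∸ suc m

shift-correct : ∀ B x → ℤ.∣ x ∣ ≤ B → ℤ.+ shift B x ≡ x ℤ.+ ℤ.+ B
shift-correct B (ℤ.+ m)    _    = refl
shift-correct B ℤ.-[1+ m ] m<B = sym (ℤₚ.⊖-≥ m<B)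

shift-bound : ∀ B x → ℤ.∣ x ∣ ≤ B → shift B x ≤ B + B
shift-bound B (ℤ.+ m)    m≤B = +-monoˡ-≤ B m≤B
shift-bound B ℤ.-[1+ m ] _   = ≤-trans (m∸n≤m B (suc m)) (m≤m+n B B)

factorSum-shift : ∀ w B → (∀ i → ℤ.∣ w i ∣ ≤ B) → ∀ i n →
                  factorSum w i n ≡ ℤ.+ factorSumℕ (λ t → shift B (w t)) i n ℤ.- ℤ.+ (n * B)
factorSum-shift w B w≤B i zero    = refl
factorSum-shift w B w≤B i (suc n) = begin
  w i ℤ.+ factorSum w (suc i) n                          ≡⟨ cong₂ ℤ._+_ letter (factorSum-shift w B w≤B (suc i) n) ⟩
  (ℤ.+ x ℤ.- ℤ.+ B) ℤ.+ (ℤ.+ s ℤ.- ℤ.+ (n * B))          ≡⟨ regroup (ℤ.+ x) (ℤ.+ s) (ℤ.+ B) (ℤ.+ (n * B)) ⟩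
  (ℤ.+ x ℤ.+ ℤ.+ s) ℤ.- (ℤ.+ B ℤ.+ ℤ.+ (n * B))          ≡⟨ cong₂ ℤ._-_ (ℤₚ.pos-+ x s) (ℤₚ.pos-+ B (n * B)) ⟨
  ℤ.+ (x + s) ℤ.- ℤ.+ (suc n * B)                        ∎
  where
  open ≡-Reasoning
  x = shift B (w i)
  s = factorSumℕ (λ t → shift B (w t)) (suc i) n
  regroup : ∀ x s b c → (x ℤ.- b) ℤ.+ (s ℤ.- c) ≡ (x ℤ.+ s) ℤ.- (b ℤ.+ c)
  regroup = ℤSolver.solve-∀
  unshift : ∀ x b → x ≡ (x ℤ.+ b) ℤ.- b
  unshift = ℤSolver.solve-∀
  letter : w i ≡ ℤ.+ x ℤ.- ℤ.+ B
  letter = trans (unshift (w i) (ℤ.+ B)) (cong (ℤ._- ℤ.+ B) (sym (shift-correct B (w i) (w≤B i))))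

-- Equal-length factors keep their sum difference under the shift, so PVHH
-- transfers to the shifted word.
pvhh⇒distinct : ∀ w B (w≤B : ∀ i → ℤ.∣ w i ∣ ≤ B) → PVHH w → DistinctAdjacentSums (λ t → shift B (w t))
pvhh⇒distinct w B w≤B pvhh i n 1≤n sameSum =
  pvhh i n 1≤n (trans (factorSum-shift w B w≤B i n)
                (trans (cong (λ s → ℤ.+ s ℤ.- ℤ.+ (n * B)) sameSum) (sym (factorSum-shift w B w≤B (i + n) n))))

mainTheorem12 : Σ (Word ℤ) (λ w → FiniteAlphabet w × PVHH w) → Σ (Word Bool) (λ b → BAS b)
mainTheorem12 (w , (alphabet , w∈alphabet) , pvhh) =
  basFromBoundedWord (λ t → shift B (w t)) (B + B) (λ t → shift-bound B (w t) (w≤B t)) (pvhh⇒distinct w B w≤B pvhh)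
  where
  B : ℕ
  B = absSum alphabet
  w≤B : ∀ i → ℤ.∣ w i ∣ ≤ B
  w≤B i = ∣member∣≤absSum (w∈alphabet i)
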